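{- Let $(G,L)$ be an instance of the \textsc{List-$5$-Coloring Problem} such that $|L(u)|\in\{0,2,3\}$ for all $u\in V(G)$ and $G$ has no $L$-good $P_3$. Suppose there is a vertex $u_0\in V(G)$ with $L(u_0)=\{1,2,3\}$. Let $A=N_{G^L}(u_0)\cap L^{(4)}$, $B=N_{G^L}(u_0)\cap L^{(5)}$, $A'=\{w\in N^2_{G^L}(u_0): A\cap N_{G^L}(w)\neq\emptyset\}$ and $B'=\{w\in N^2_{G^L}(u_0): B\cap N_{G^L}(w)\neq\emptyset\}$. Then: (1) $|L(u)|\in\{2,3\}$ for every $u\in N^2_{G^L}[u_0]$; (2) $L(w)=\{4,5\}$ for every $w\in N^2_{G^L}(u_0)$; (3) $N^2_{G^L}(u_0)=A'\cup B'$; (4) both $A$ and $B$ are cliques of $G^L$; (5) every vertex $w\in N^2_{G^L}(u_0)$ is either complete or anticomplete to $A$ in $G^L$, and either complete or anticomplete to $B$ in $G^L$; in particular $A'$ is complete to $A$ in $G^L$ and $B'$ is complete to $B$ in $G^L$; (6) both $A'$ and $B'$ are cliques of $G^L$; (7) if in addition $|N^2_{G^L}(u_0)|\geq 2$ and $|A'|,|B'|\leq 1$, then: $|A'|=|B'|=1$ and $A'\cap B'=\emptyset$; $A,B\neq\emptyset$ and $A\cap B=\emptyset$; $A'$ is anticomplete to $B$ in $G$ and $B'$ is anticomplete to $A$ in $G$; and $L(a)\cap L(b)=\emptyset$ for every $a\in A$ and every $b\in B$.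
   Context: Graphs are finite and simple. A $5$-list-assignment of $G$ is a map $L:V(G)\to 2^{\{1,\dots,5\}}$; an instance of the \textsc{List-$5$-Coloring Problem} is a pair $(G,L)$. For $i\in\{1,\dots,5\}$, $L^{(i)}=\{v\in V(G): i\in L(v)\}$. $G^L$ is the graph with $V(G^L)=V(G)$ and $E(G^L)=\{uv\in E(G): L(u)\cap L(v)\neq\emptyset\}$. In a graph $H$, $N_H(v)$ is the set of neighbors of $v$, $N^2_H(v)$ is the set of vertices at distance exactly $2$ from $v$, and $N^2_H[v]$ the set of vertices at distance at most $2$. A set $Z$ is complete (anticomplete) to $W$ if $Z\cap W=\emptyset$ and every vertex of $Z$ is adjacent (nonadjacent) to every vertex of $W$; a single vertex $z$ is complete/anticomplete to $W$ if $\{z\}$ is. An induced $P_3$ $x_1-x_2-x_3$ is a triple of vertices inducing exactly the edges $x_1x_2,x_2x_3$. A triple $(I_1,I_2,I_3)$ of subsets of $\{1,\dots,5\}$ is good if each $|I_j|\ge2$ and all pairwise intersections are nonempty; an $L$-good $P_3$ is an induced $P_3$ $x_1-x_2-x_3$ with $(L(x_1),L(x_2),L(x_3))$ good. -}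

module Defs where

open import Data.Bool using (Bool; true; false)
open import Data.Nat using (ℕ; _≥_)
open import Data.Fin using (Fin; zero; suc)
open import Data.Fin.Subset using (Subset; _∈_; _∩_; Nonempty; ∣_∣)
open import Data.Vec using (_∷_; [])
open import Data.Product using (_×_; ∃; Σ)
open import Data.Sum using (_⊎_)
open import Data.Empty using (⊥)
open import Relation.Nullary using (¬_)
open import Relation.Binary.PropositionalEquality using (_≡_; _≢_)

record Graph : Set where
  field
    n      : ℕ
    E      : Fin n → Fin n → Bool
    sym    : ∀ u v → E u v ≡ E v u
    irrefl : ∀ u → E u u ≡ false

open Graph public

V : Graph → Set
V G = Fin (n G)

Adj : (G : Graph) → V G → V G → Set
Adj G u v = E G u v ≡ true

-- Colours 1..5 are represented by Fin 5 (colour i ↦ index i-1);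
-- a 5-list-assignment is a map V(G) → Subset 5.
ListAssign : Graph → Set
ListAssign G = V G → Subset 5

col4 col5 : Fin 5
col4 = suc (suc (suc zero))
col5 = suc (suc (suc (suc zero)))

L123 L45 : Subset 5
L123 = true ∷ true ∷ true ∷ false ∷ false ∷ []
L45  = false ∷ false ∷ false ∷ true ∷ true ∷ []

VSet : Graph → Set₁
VSet G = V G → Set

AdjL : (G : Graph) → ListAssign G → V G → V G → Set
AdjL G L u v = Adj G u v × Nonempty (L u ∩ L v)

Good : Subset 5 → Subset 5 → Subset 5 → Set
Good I₁ I₂ I₃ = ∣ I₁ ∣ ≥ 2 × ∣ I₂ ∣ ≥ 2 × ∣ I₃ ∣ ≥ 2
              × Nonempty (I₁ ∩ I₂) × Nonempty (I₁ ∩ I₃) × Nonempty (I₂ ∩ I₃)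

InducedP3 : (G : Graph) → V G → V G → V G → Set
InducedP3 G x₁ x₂ x₃ = x₁ ≢ x₃ × Adj G x₁ x₂ × Adj G x₂ x₃ × ¬ Adj G x₁ x₃

LGoodP3 : (G : Graph) → ListAssign G → V G → V G → V G → Set
LGoodP3 G L x₁ x₂ x₃ = InducedP3 G x₁ x₂ x₃ × Good (L x₁) (L x₂) (L x₃)

NoLGoodP3 : (G : Graph) → ListAssign G → Set
NoLGoodP3 G L = ∀ x₁ x₂ x₃ → ¬ LGoodP3 G L x₁ x₂ x₃

module Nbhd {W : Set} (H : W → W → Set) where
  N : W → W → Set
  N v u = H v u
  N2 : W → W → Set
  N2 v w = w ≢ v × ¬ H v w × ∃ λ u → H v u × H u w
  N2c : W → W → Set
  N2c v w = w ≡ v ⊎ H v w ⊎ N2 v w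
  Clique : (W → Set) → Set
  Clique S = ∀ x y → S x → S y → x ≢ y → H x y
  Complete : (W → Set) → (W → Set) → Set
  Complete Z Y = (∀ x → Z x → Y x → ⊥) × (∀ z y → Z z → Y y → H z y)
  Anticomplete : (W → Set) → (W → Set) → Set
  Anticomplete Z Y = (∀ x → Z x → Y x → ⊥) × (∀ z y → Z z → Y y → ¬ H z y)
  CompleteV : W → (W → Set) → Set
  CompleteV z Y = Complete (λ x → x ≡ z) Y
  AnticompleteV : W → (W → Set) → Set
  AnticompleteV z Y = Anticomplete (λ x → x ≡ z) Y

AtMostOne : {W : Set} → (W → Set) → Set
AtMostOne S = ∀ x y → S x → S y → x ≡ y

ExactlyOne : {W : Set} → (W → Set) → Set
ExactlyOne S = (∃ λ x → S x) × AtMostOne S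

AtLeastTwo : {W : Set} → (W → Set) → Set
AtLeastTwo S = ∃ λ x → ∃ λ y → S x × S y × x ≢ y

module Sets (G : Graph) (L : ListAssign G) (u₀ : V G) where
  open Nbhd (AdjL G L)
  A : V G → Set
  A v = AdjL G L u₀ v × col4 ∈ L v
  B : V G → Set
  B v = AdjL G L u₀ v × col5 ∈ L v
  A' : V G → Set
  A' w = N2 u₀ w × ∃ λ a → A a × AdjL G L w a
  B' : V G → Set
  B' w = N2 u₀ w × ∃ λ b → B b × AdjL G L w b

NonemptyV : {W : Set} → (W → Set) → Set
NonemptyV S = ∃ λ x → S x

Disjoint : {W : Set} → (W → Set) → (W → Set) → Set
Disjoint S T = ∀ x → S x → T x → ⊥

module Submission where

open import Defs
open import Data.Fin.Subset using (Subset; _∩_; ∣_∣; ⊥)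
open import Data.Product using (_×_)
open import Data.Sum using (_⊎_)
open import Relation.Binary.PropositionalEquality using (_≡_)

open import Data.Bool using (true; false)
import Data.Bool.Properties as Bool
open import Data.Nat using (_≥_; s≤s; z≤n)
open import Data.Fin using (Fin; zero; suc)
import Data.Fin.Properties as Fin
open import Data.Fin.Subset using (_∈_; Nonempty)
open import Data.Fin.Subset.Properties
  using (Empty-unique; nonempty?; x∈p∩q⁺; x∈p∩q⁻; ∩-comm; x∈p⇒∣p-x∣<∣p∣; _∈?_)
open import Data.Vec using (_∷_; []; here; there)
open import Data.Product using (_,_; proj₁; proj₂; ∃)
open import Data.Sum using (inj₁; inj₂)
open import Function using (_∘′_)
open import Relation.Nullary using (¬_; Dec; yes; no; contradiction)
open import Relation.Nullary.Decidable using (_×-dec_)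
open import Relation.Binary.PropositionalEquality
  using (_≢_; refl; trans; cong; subst; ≢-sym) renaming (sym to ≡-sym)

-- Proof idea: since every nonempty list has at least two colours, the absence
-- of an L-good P₃ says that two G^L-neighbours of a common vertex that share a
-- colour are themselves adjacent in G^L (lemma AdjL-closed).  Applied around
-- u₀ this forces every vertex at distance two to have a list disjoint from
-- {1,2,3}, i.e. equal to {4,5}; the neighbours of u₀ carrying colour 4 (or 5)
-- then form a clique, and a vertex at distance two seeing one of them sees all.
-- For (7), a vertex x ∈ A' and a different y ∈ B' are the only members of
-- A' ∪ B', and any colour shared by a ∈ A and b ∈ B would make x adjacent to b.

nonempty-∩ : ∀ {m} {c : Fin m} {p q : Subset m} → c ∈ p → c ∈ q → Nonempty (p ∩ q)
nonempty-∩ c∈p c∈q = _ , x∈p∩q⁺ (c∈p , c∈q)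

nonempty-∩ʳ : ∀ {m} {p q : Subset m} → Nonempty (p ∩ q) → Nonempty q
nonempty-∩ʳ {p = p} {q} (c , c∈p∩q) = c , proj₂ (x∈p∩q⁻ p q c∈p∩q)

nonempty-∩-comm : ∀ {m} {p q : Subset m} → Nonempty (p ∩ q) → Nonempty (q ∩ p)
nonempty-∩-comm {p = p} {q} = subst Nonempty (∩-comm p q)

nonempty-∩ˡ : ∀ {m} {p q : Subset m} → Nonempty (p ∩ q) → Nonempty p
nonempty-∩ˡ = nonempty-∩ʳ ∘′ nonempty-∩-comm

nonempty⇒∣p∣≢0 : ∀ {m} {p : Subset m} → Nonempty p → ∣ p ∣ ≢ 0
nonempty⇒∣p∣≢0 (_ , c∈p) ∣p∣≡0 with x∈p⇒∣p-x∣<∣p∣ c∈p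
... | ∣p-c∣<∣p∣ rewrite ∣p∣≡0 with ∣p-c∣<∣p∣
... | ()

∈L45⇒col4⊎col5 : ∀ {c} → c ∈ L45 → c ≡ col4 ⊎ c ≡ col5
∈L45⇒col4⊎col5 (there (there (there here)))         = inj₁ refl
∈L45⇒col4⊎col5 (there (there (there (there here)))) = inj₂ refl
∈L45⇒col4⊎col5 (there (there (there (there (there ())))))

col4∈L45 : col4 ∈ L45
col4∈L45 = there (there (there here))

col5∈L45 : col5 ∈ L45
col5∈L45 = there (there (there (there here)))

∣p∣≥2∧L123∩p-empty⇒p≡L45 : (p : Subset 5) → ∣ p ∣ ≥ 2 → ¬ Nonempty (L123 ∩ p) → p ≡ L45
∣p∣≥2∧L123∩p-empty⇒p≡L45 (true ∷ _) _ disj =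
  contradiction (zero , here) disj
∣p∣≥2∧L123∩p-empty⇒p≡L45 (false ∷ true ∷ _) _ disj =
  contradiction (suc zero , there here) disj
∣p∣≥2∧L123∩p-empty⇒p≡L45 (false ∷ false ∷ true ∷ _) _ disj =
  contradiction (suc (suc zero) , there (there here)) disj
∣p∣≥2∧L123∩p-empty⇒p≡L45 (false ∷ false ∷ false ∷ true  ∷ true  ∷ []) _        _ = refl
∣p∣≥2∧L123∩p-empty⇒p≡L45 (false ∷ false ∷ false ∷ true  ∷ false ∷ []) (s≤s ()) _
∣p∣≥2∧L123∩p-empty⇒p≡L45 (false ∷ false ∷ false ∷ false ∷ true  ∷ []) (s≤s ()) _
∣p∣≥2∧L123∩p-empty⇒p≡L45 (false ∷ false ∷ false ∷ false ∷ false ∷ []) ()       _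

module _ (G : Graph) (L : ListAssign G) where

  Adj-sym : ∀ {u v} → Adj G u v → Adj G v u
  Adj-sym {u} {v} = trans (Graph.sym G v u)

  AdjL-sym : ∀ {u v} → AdjL G L u v → AdjL G L v u
  AdjL-sym (uv , shared) = Adj-sym uv , nonempty-∩-comm shared

  AdjL? : ∀ u v → Dec (AdjL G L u v)
  AdjL? u v = (E G u v Bool.≟ true) ×-dec nonempty? (L u ∩ L v)

  AdjL-closed : (∀ u → Nonempty (L u) → ∣ L u ∣ ≥ 2) → NoLGoodP3 G L →
                ∀ {x₁ x₂ x₃} → x₁ ≢ x₃ → AdjL G L x₁ x₂ → AdjL G L x₂ x₃ →
                Nonempty (L x₁ ∩ L x₃) → AdjL G L x₁ x₃
  AdjL-closed ≥2 noP3 {x₁} {x₂} {x₃} x₁≢x₃ (x₁x₂ , s₁₂) (x₂x₃ , s₂₃) s₁₃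
    with E G x₁ x₃ Bool.≟ true
  ... | yes x₁x₃ = x₁x₃ , s₁₃
  ... | no ¬x₁x₃ = contradiction
          ((x₁≢x₃ , x₁x₂ , x₂x₃ , ¬x₁x₃) ,
           (≥2 x₁ (nonempty-∩ˡ s₁₂) , ≥2 x₂ (nonempty-∩ʳ s₁₂) , ≥2 x₃ (nonempty-∩ʳ s₂₃) ,
            s₁₂ , s₁₃ , s₂₃))
          (noP3 x₁ x₂ x₃)

module AroundU₀ (G : Graph) (L : ListAssign G)
  (sizes : ∀ u → ∣ L u ∣ ≡ 0 ⊎ ∣ L u ∣ ≡ 2 ⊎ ∣ L u ∣ ≡ 3)
  (noP3 : NoLGoodP3 G L) (u₀ : V G) (L₀ : L u₀ ≡ L123) where
  open Nbhd (AdjL G L)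
  open Sets G L u₀

  nonempty⇒∣L∣≡2⊎3 : ∀ u → Nonempty (L u) → ∣ L u ∣ ≡ 2 ⊎ ∣ L u ∣ ≡ 3
  nonempty⇒∣L∣≡2⊎3 u Lu≠∅ with sizes u
  ... | inj₁ ∣Lu∣≡0 = contradiction ∣Lu∣≡0 (nonempty⇒∣p∣≢0 Lu≠∅)
  ... | inj₂ ∣Lu∣≡2⊎3 = ∣Lu∣≡2⊎3

  nonempty⇒∣L∣≥2 : ∀ u → Nonempty (L u) → ∣ L u ∣ ≥ 2
  nonempty⇒∣L∣≥2 u Lu≠∅ with nonempty⇒∣L∣≡2⊎3 u Lu≠∅
  ... | inj₁ ∣Lu∣≡2 rewrite ∣Lu∣≡2 = s≤s (s≤s z≤n)
  ... | inj₂ ∣Lu∣≡3 rewrite ∣Lu∣≡3 = s≤s (s≤s z≤n)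

  closed : ∀ {x₁ x₂ x₃} → x₁ ≢ x₃ → AdjL G L x₁ x₂ → AdjL G L x₂ x₃ →
           Nonempty (L x₁ ∩ L x₃) → AdjL G L x₁ x₃
  closed = AdjL-closed G L nonempty⇒∣L∣≥2 noP3

  -- S col4, S col5, S' col4 and S' col5 are definitionally A, B, A' and B'.
  S : Fin 5 → V G → Set
  S c v = AdjL G L u₀ v × c ∈ L v

  S' : Fin 5 → V G → Set
  S' c w = N2 u₀ w × ∃ λ a → S c a × AdjL G L w a

  S? : ∀ c v → Dec (S c v)
  S? c v = AdjL? G L u₀ v ×-dec (c ∈? L v)

  N2⇒¬S : ∀ {c w} → N2 u₀ w → ¬ S c w
  N2⇒¬S (_ , ¬u₀w , _) (u₀w , _) = ¬u₀w u₀w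

  N2⇒≢N : ∀ {w v} → N2 u₀ w → AdjL G L u₀ v → w ≢ v
  N2⇒≢N (_ , ¬u₀w , _) u₀v refl = ¬u₀w u₀v

  N2⇒L≡L45 : ∀ {w} → N2 u₀ w → L w ≡ L45
  N2⇒L≡L45 {w} (w≢u₀ , ¬u₀w , u , u₀u , uw) =
    ∣p∣≥2∧L123∩p-empty⇒p≡L45 (L w) (nonempty⇒∣L∣≥2 w (nonempty-∩ʳ (proj₂ uw)))
      (subst (λ p → ¬ Nonempty (p ∩ L w)) L₀ u₀w-disjoint)
    where
    u₀w-disjoint : ¬ Nonempty (L u₀ ∩ L w)
    u₀w-disjoint shared = ¬u₀w (closed (≢-sym w≢u₀) u₀u uw shared)

  N2⇒∈L : ∀ {c w} → c ∈ L45 → N2 u₀ w → c ∈ L w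
  N2⇒∈L {c} c∈L45 n2 = subst (c ∈_) (≡-sym (N2⇒L≡L45 n2)) c∈L45

  N2c⇒∣L∣≡2⊎3 : ∀ u → N2c u₀ u → ∣ L u ∣ ≡ 2 ⊎ ∣ L u ∣ ≡ 3
  N2c⇒∣L∣≡2⊎3 u (inj₁ refl)                   = inj₂ (cong ∣_∣ L₀)
  N2c⇒∣L∣≡2⊎3 u (inj₂ (inj₁ (_ , shared)))   = nonempty⇒∣L∣≡2⊎3 u (nonempty-∩ʳ shared)
  N2c⇒∣L∣≡2⊎3 u (inj₂ (inj₂ n2))             = inj₁ (cong ∣_∣ (N2⇒L≡L45 n2))

  N2⊆A'∪B' : ∀ w → N2 u₀ w → A' w ⊎ B' w
  N2⊆A'∪B' w n2@(_ , _ , u , u₀u , uw@(_ , c , c∈Lu∩Lw))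
    with x∈p∩q⁻ (L u) (L w) c∈Lu∩Lw
  ... | c∈Lu , c∈Lw with ∈L45⇒col4⊎col5 (subst (c ∈_) (N2⇒L≡L45 n2) c∈Lw)
  ... | inj₁ refl = inj₁ (n2 , u , (u₀u , c∈Lu) , AdjL-sym G L uw)
  ... | inj₂ refl = inj₂ (n2 , u , (u₀u , c∈Lu) , AdjL-sym G L uw)

  A'∪B'⊆N2 : ∀ w → A' w ⊎ B' w → N2 u₀ w
  A'∪B'⊆N2 w (inj₁ (n2 , _)) = n2
  A'∪B'⊆N2 w (inj₂ (n2 , _)) = n2

  S-clique : ∀ c → Clique (S c)
  S-clique c x y (u₀x , c∈Lx) (u₀y , c∈Ly) x≢y =
    closed x≢y (AdjL-sym G L u₀x) u₀y (nonempty-∩ c∈Lx c∈Ly)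

  N2-adjacent-to-S⇒complete : ∀ {c w a} → c ∈ L45 → N2 u₀ w → S c a → AdjL G L w a →
                               ∀ a' → S c a' → AdjL G L w a'
  N2-adjacent-to-S⇒complete {c} {w} {a} c∈L45 n2 a∈S wa a' a'∈S with a Fin.≟ a'
  ... | yes refl = wa
  ... | no a≢a'  = closed (N2⇒≢N n2 (proj₁ a'∈S)) wa (S-clique c a a' a∈S a'∈S a≢a')
                          (nonempty-∩ (N2⇒∈L c∈L45 n2) (proj₂ a'∈S))

  N2-complete⊎anticomplete-S : ∀ {c w} → c ∈ L45 → N2 u₀ w →
                                CompleteV w (S c) ⊎ AnticompleteV w (S c)
  N2-complete⊎anticomplete-S {c} {w} c∈L45 n2
    with Fin.any? (λ a → S? c a ×-dec AdjL? G L w a)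
  ... | yes (a , a∈S , wa) = inj₁ ((λ { _ refl → N2⇒¬S n2 }) ,
          λ { _ a' refl a'∈S → N2-adjacent-to-S⇒complete c∈L45 n2 a∈S wa a' a'∈S })
  ... | no ∄a = inj₂ ((λ { _ refl → N2⇒¬S n2 }) ,
          λ { _ a' refl a'∈S wa' → ∄a (a' , a'∈S , wa') })

  S'-complete-S : ∀ {c} → c ∈ L45 → Complete (S' c) (S c)
  S'-complete-S c∈L45 =
    (λ _ (n2 , _) → N2⇒¬S n2) ,
    λ _ a' (n2 , a , a∈S , wa) a'∈S → N2-adjacent-to-S⇒complete c∈L45 n2 a∈S wa a' a'∈S

  S'-clique : ∀ {c} → c ∈ L45 → Clique (S' c)
  S'-clique c∈L45 x y x∈S'@(n2x , a , a∈S , xa) y∈S'@(n2y , _) x≢y =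
    closed x≢y xa (AdjL-sym G L (proj₂ (S'-complete-S c∈L45) y a y∈S' a∈S))
           (nonempty-∩ (N2⇒∈L c∈L45 n2x) (N2⇒∈L c∈L45 n2y))

  distinct-A'-B'-members : AtLeastTwo (N2 u₀) → AtMostOne A' → AtMostOne B' →
                           ∃ λ x → ∃ λ y → A' x × B' y × x ≢ y
  distinct-A'-B'-members (x , y , n2x , n2y , x≢y) A'≤1 B'≤1
    with N2⊆A'∪B' x n2x | N2⊆A'∪B' y n2y
  ... | inj₁ x∈A' | inj₁ y∈A' = contradiction (A'≤1 x y x∈A' y∈A') x≢y
  ... | inj₂ x∈B' | inj₂ y∈B' = contradiction (B'≤1 x y x∈B' y∈B') x≢y
  ... | inj₁ x∈A' | inj₂ y∈B' = x , y , x∈A' , y∈B' , x≢y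
  ... | inj₂ x∈B' | inj₁ y∈A' = y , x , y∈A' , x∈B' , ≢-sym x≢y

  module Separated {x y} (x∈A' : A' x) (y∈B' : B' y) (x≢y : x ≢ y)
                   (A'≤1 : AtMostOne A') (B'≤1 : AtMostOne B') where

    A'-B'-disjoint : Disjoint A' B'
    A'-B'-disjoint z z∈A' z∈B' = x≢y (trans (A'≤1 x z x∈A' z∈A') (B'≤1 z y z∈B' y∈B'))

    A-nonempty : NonemptyV A
    A-nonempty = let (_ , a , a∈A , _) = x∈A' in a , a∈A

    B-nonempty : NonemptyV B
    B-nonempty = let (_ , b , b∈B , _) = y∈B' in b , b∈B

    x-complete-A : ∀ a → A a → AdjL G L x a
    x-complete-A a = proj₂ (S'-complete-S col4∈L45) x a x∈A'

    A-B-disjoint : Disjoint A B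
    A-B-disjoint a a∈A a∈B = A'-B'-disjoint x x∈A' (proj₁ x∈A' , a , a∈B , x-complete-A a a∈A)

    A'-B-anticomplete : Nbhd.Anticomplete (Adj G) A' B
    A'-B-anticomplete =
      (λ z z∈A' → N2⇒¬S (proj₁ z∈A')) ,
      λ z b z∈A' b∈B zb → A'-B'-disjoint z z∈A'
        (proj₁ z∈A' , b , b∈B , zb , nonempty-∩ (N2⇒∈L col5∈L45 (proj₁ z∈A')) (proj₂ b∈B))

    B'-A-anticomplete : Nbhd.Anticomplete (Adj G) B' A
    B'-A-anticomplete =
      (λ z z∈B' → N2⇒¬S (proj₁ z∈B')) ,
      λ z a z∈B' a∈A za → A'-B'-disjoint z
        (proj₁ z∈B' , a , a∈A , za , nonempty-∩ (N2⇒∈L col4∈L45 (proj₁ z∈B')) (proj₂ a∈A)) z∈B'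

    -- A shared colour would make a and b adjacent through u₀, and then x adjacent to b through a.
    A-B-lists-disjoint : ∀ a b → A a → B b → L a ∩ L b ≡ ⊥
    A-B-lists-disjoint a b a∈A b∈B = Empty-unique λ shared →
      A'-B'-disjoint x x∈A' (proj₁ x∈A' , b , b∈B , xb (ab shared))
      where
      a≢b : a ≢ b
      a≢b refl = A-B-disjoint a a∈A b∈B
      ab : Nonempty (L a ∩ L b) → AdjL G L a b
      ab = closed a≢b (AdjL-sym G L (proj₁ a∈A)) (proj₁ b∈B)
      xb : AdjL G L a b → AdjL G L x b
      xb ab = closed (N2⇒≢N (proj₁ x∈A') (proj₁ b∈B)) (x-complete-A a a∈A) ab
                     (nonempty-∩ (N2⇒∈L col5∈L45 (proj₁ x∈A')) (proj₂ b∈B))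

lemma4p2 : (G : Graph) (L : ListAssign G) →
    (∀ u → ∣ L u ∣ ≡ 0 ⊎ ∣ L u ∣ ≡ 2 ⊎ ∣ L u ∣ ≡ 3) →
    NoLGoodP3 G L →
    (u₀ : V G) → L u₀ ≡ L123 →
    let open Nbhd (AdjL G L) in
    let open Sets G L u₀ in
    (∀ u → N2c u₀ u → ∣ L u ∣ ≡ 2 ⊎ ∣ L u ∣ ≡ 3)
    × (∀ w → N2 u₀ w → L w ≡ L45)
    × (∀ w → N2 u₀ w → A' w ⊎ B' w) × (∀ w → A' w ⊎ B' w → N2 u₀ w)
    × Clique A × Clique B
    × (∀ w → N2 u₀ w → (CompleteV w A ⊎ AnticompleteV w A)
                      × (CompleteV w B ⊎ AnticompleteV w B))
    × Complete A' A × Complete B' B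
    × Clique A' × Clique B'
    × (AtLeastTwo (N2 u₀) → AtMostOne A' → AtMostOne B' →
         ExactlyOne A' × ExactlyOne B' × Disjoint A' B'
       × NonemptyV A × NonemptyV B × Disjoint A B
       × Nbhd.Anticomplete (Adj G) A' B × Nbhd.Anticomplete (Adj G) B' A
       × (∀ a b → A a → B b → L a ∩ L b ≡ ⊥))
lemma4p2 G L sizes noP3 u₀ L₀ =
  N2c⇒∣L∣≡2⊎3 , (λ _ → N2⇒L≡L45) , N2⊆A'∪B' , A'∪B'⊆N2 ,
  S-clique col4 , S-clique col5 ,
  (λ _ n2 → N2-complete⊎anticomplete-S col4∈L45 n2 , N2-complete⊎anticomplete-S col5∈L45 n2) ,
  S'-complete-S col4∈L45 , S'-complete-S col5∈L45 ,
  S'-clique col4∈L45 , S'-clique col5∈L45 ,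
  λ two A'≤1 B'≤1 →
    let (x , y , x∈A' , y∈B' , x≢y) = distinct-A'-B'-members two A'≤1 B'≤1
        open Separated x∈A' y∈B' x≢y A'≤1 B'≤1
    in ((x , x∈A') , A'≤1) , ((y , y∈B') , B'≤1) , A'-B'-disjoint ,
       A-nonempty , B-nonempty , A-B-disjoint ,
       A'-B-anticomplete , B'-A-anticomplete , A-B-lists-disjoint
  where open AroundU₀ G L sizes noP3 u₀ L₀
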